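{- Let $\Delta\ge3$ and let $a$ be an integer with $0\le a\le 2^{\Delta-1}-2$ and $a\ne 2^{\Delta-1}-(\Delta-1)$. Then there exist $y_1,\dots,y_{\Delta-2}\in\mathscr{M}_{\Delta-1}$ with $y_1+y_2+\cdots+y_{\Delta-2}=a$.
   Context: For a positive integer $t$, $\mathscr{M}_{t}=\{2^0-1,2^1-1,\dots,2^{t-1}-1\}$; in particular $\mathscr{M}_{\Delta-1}=\{2^i-1: i=0,1,\dots,\Delta-2\}$. -}

module Defs where

open import Data.Nat using (ℕ; _^_; _∸_; _<_)
open import Data.Product using (Σ; _×_)
open import Relation.Binary.PropositionalEquality using (_≡_)

InM : ℕ → ℕ → Set
InM t x = Σ ℕ (λ i → (i < t) × (x ≡ 2 ^ i ∸ 1))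

module Submission where

-- Write q i = 2^i - 1, so 𝓜_t = {q i : i < t}, and say that a is
-- (k,t)-representable when a is a sum of k elements of 𝓜_t.  With
-- k = Δ - 2 the theorem says: every a < q (k+1) is (k, k+1)-representable
-- except the single value a = q (k+1) - k.  The proof is an induction on k
-- driven by the doubling identity q (k+1) = 2 q k + 1.
--   * Closure lemmas: representations may be padded by zeros (0 = q 0),
--     may draw from a larger 𝓜_t, and may receive one more summand q i.
--   * The excluded value gap k = q (k+1) - k is defined by recursion
--     (gap (k+1) = q (k+1) + gap k) and is itself representable with one
--     MORE summand; this is how the step k → k+1 reaches it.
--   * Step: with Q = q (k+1), a value a < 2Q + 1 is either below Q (use the
--     induction hypothesis and pad with 0, or the gap representation if a
--     is the old gap), or a = Q + b with b ≤ Q (put Q first; b < Q is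
--     handled by induction, b = Q by Q plus zeros, where Q + Q is the
--     gap when k = 0).

open import Defs
open import Data.Nat using (ℕ; _+_; _∸_; _^_; _≤_; _<_; zero; suc; s≤s; z<s)
open import Data.Nat.Properties
open import Data.Fin using (Fin)
open import Data.Product using (Σ; _×_; _,_)
open import Data.Sum using (_⊎_; inj₁; inj₂)
open import Data.Vec.Functional using (foldr; _∷_)
open import Data.Empty using (⊥-elim)
open import Relation.Binary.PropositionalEquality
open import Relation.Nullary using (¬_; yes; no)

open ≡-Reasoning

q : ℕ → ℕ
q i = 2 ^ i ∸ 1

double-pred : ∀ n → 0 < n → (n + (n + 0)) ∸ 1 ≡ suc ((n ∸ 1) + (n ∸ 1))
double-pred (suc p) _ = begin
  p + suc (p + 0) ≡⟨ +-suc p (p + 0) ⟩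
  suc (p + (p + 0)) ≡⟨ cong (λ z → suc (p + z)) (+-identityʳ p) ⟩
  suc (p + p) ∎

q-double : ∀ i → q (suc i) ≡ suc (q i + q i)
q-double i = double-pred (2 ^ i) (m^n>0 2 i)

shift-suc : ∀ x y k → x + y + suc k ≡ suc (x + (y + k))
shift-suc x y k = begin
  x + y + suc k ≡⟨ +-assoc x y (suc k) ⟩
  x + (y + suc k) ≡⟨ cong (x +_) (+-suc y k) ⟩
  x + suc (y + k) ≡⟨ +-suc x (y + k) ⟩
  suc (x + (y + k)) ∎

Representable : ℕ → ℕ → ℕ → Set
Representable k t a =
  Σ (Fin k → ℕ) (λ y → ((i : Fin k) → InM t (y i)) × (foldr _+_ 0 y ≡ a))

widen : ∀ {k t a} → Representable k t a → Representable k (suc t) a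
widen (y , inM , sum) = y , (λ i → lift (inM i)) , sum
  where
  lift : ∀ {t x} → InM t x → InM (suc t) x
  lift (j , j<t , x≡qj) = j , m<n⇒m<1+n j<t , x≡qj

cons : ∀ {k t a} i → i < t → Representable k t a → Representable (suc k) t (q i + a)
cons i i<t (y , inM , sum) = (q i ∷ y) , inM′ , cong (q i +_) sum
  where
  inM′ : (j : Fin _) → InM _ _
  inM′ Fin.zero = i , i<t , refl
  inM′ (Fin.suc j) = inM j

zeros : ∀ k {t} → Representable k (suc t) 0
zeros zero = (λ ()) , (λ ()) , refl
zeros (suc k) = cons 0 z<s (zeros k)

pad : ∀ {k t a} → Representable k t a → Representable (suc k) (suc t) a
pad r = cons 0 z<s (widen r)

gap : ℕ → ℕ
gap zero = 1
gap (suc k) = q (suc k) + gap k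

gap-spec : ∀ k → gap k + k ≡ q (suc k)
gap-spec zero = refl
gap-spec (suc k) = begin
  q (suc k) + gap k + suc k ≡⟨ shift-suc (q (suc k)) (gap k) k ⟩
  suc (q (suc k) + (gap k + k)) ≡⟨ cong (λ z → suc (q (suc k) + z)) (gap-spec k) ⟩
  suc (q (suc k) + q (suc k)) ≡⟨ sym (q-double (suc k)) ⟩
  q (suc (suc k)) ∎

-- gap k, excluded for k summands, is a sum of k + 1 summands:
-- gap k = q 1 + q 1 + q 2 + ... + q k.
gap-representable : ∀ k → Representable (suc k) (suc (suc k)) (gap k)
gap-representable zero = cons 1 (s≤s z<s) (zeros 0)
gap-representable (suc k) = cons (suc k) (m<n⇒m<1+n (n<1+n (suc k))) (widen (gap-representable k))

-- The largest summand q (k+1) of 𝓜_(k+2) is a sum of k elements of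
-- 𝓜_(k+2) (itself plus zeros) unless k = 0; for k = 0, 2 q 1 is the gap.
top-representable : ∀ k → ¬ (q (suc k) + q (suc k) + suc k ≡ q (suc (suc k))) →
                    Representable k (suc (suc k)) (q (suc k))
top-representable zero not-gap = ⊥-elim (not-gap refl)
top-representable (suc k) _ =
  subst (Representable _ _) (+-identityʳ (q (suc (suc k))))
        (cons (suc (suc k)) (n<1+n (suc (suc k))) (zeros k))

below-or-above : ∀ Q a → a < suc (Q + Q) → a < Q ⊎ Σ ℕ (λ b → b ≤ Q × a ≡ Q + b)
below-or-above Q a a<2Q+1 with a <? Q
... | yes a<Q = inj₁ a<Q
... | no a≮Q = inj₂ (a ∸ Q , b≤Q , sym a≡Q+b)
  where
  a≡Q+b : Q + (a ∸ Q) ≡ a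
  a≡Q+b = m+[n∸m]≡n (≮⇒≥ a≮Q)
  b≤Q : a ∸ Q ≤ Q
  b≤Q = +-cancelˡ-≤ Q (a ∸ Q) Q (subst (_≤ Q + Q) (sym a≡Q+b) (m<1+n⇒m≤n a<2Q+1))

representable : ∀ k a → a < q (suc k) → ¬ (a + k ≡ q (suc k)) → Representable k (suc k) a
representable zero zero _ _ = zeros 0
representable zero (suc a) (s≤s ()) _
representable (suc k) a a<q not-gap
  with below-or-above (q (suc k)) a (subst (a <_) (q-double (suc k)) a<q)
... | inj₁ a<Q with a + k ≟ q (suc k)
...   | yes is-old-gap =
        subst (Representable _ _) (+-cancelʳ-≡ k (gap k) a (trans (gap-spec k) (sym is-old-gap)))
              (gap-representable k)
...   | no not-old-gap = pad (representable k a a<Q not-old-gap)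
representable (suc k) _ a<q not-gap | inj₂ (b , b≤Q , refl) =
  cons (suc k) (n<1+n (suc k)) upper
  where
  Q = q (suc k)
  -- If b were the old gap, Q + b would be the new one.
  b-not-gap : ¬ (b + k ≡ Q)
  b-not-gap b-gap = not-gap (begin
    Q + b + suc k ≡⟨ shift-suc Q b k ⟩
    suc (Q + (b + k)) ≡⟨ cong (λ z → suc (Q + z)) b-gap ⟩
    suc (Q + Q) ≡⟨ sym (q-double (suc k)) ⟩
    q (suc (suc k)) ∎)
  upper : Representable k (suc (suc k)) b
  upper with m≤n⇒m<n∨m≡n b≤Q
  ... | inj₁ b<Q = widen (representable k b b<Q b-not-gap)
  ... | inj₂ refl = top-representable k not-gap

≤∸2⇒<∸1 : ∀ {a n} → 2 ≤ n → a ≤ n ∸ 2 → a < n ∸ 1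
≤∸2⇒<∸1 2≤n a≤n∸2 = ≤-<-trans a≤n∸2 (∸-monoʳ-< (n<1+n 1) 2≤n)

+≡∸1⇒≡∸ : ∀ a k n → a + k ≡ n ∸ 1 → a ≡ n ∸ suc k
+≡∸1⇒≡∸ a k n eq = begin
  a ≡⟨ sym (m+n∸n≡m a k) ⟩
  a + k ∸ k ≡⟨ cong (_∸ k) eq ⟩
  n ∸ 1 ∸ k ≡⟨ ∸-+-assoc n 1 k ⟩
  n ∸ suc k ∎

mainTheorem7 : (Δ : ℕ) → 3 ≤ Δ → (a : ℕ) → a ≤ 2 ^ (Δ ∸ 1) ∸ 2 → ¬ (a ≡ 2 ^ (Δ ∸ 1) ∸ (Δ ∸ 1)) →
    Σ (Fin (Δ ∸ 2) → ℕ) (λ y → ((i : Fin (Δ ∸ 2)) → InM (Δ ∸ 1) (y i)) × (foldr _+_ 0 y ≡ a))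
mainTheorem7 (suc (suc zero)) (s≤s (s≤s ())) _ _ _
mainTheorem7 (suc (suc (suc m))) _ a a≤ a≢ =
  representable (suc m) a (≤∸2⇒<∸1 2≤2^ a≤) (λ gap-eq → a≢ (+≡∸1⇒≡∸ a (suc m) (2 ^ suc (suc m)) gap-eq))
  where
  2≤2^ : 2 ≤ 2 ^ suc (suc m)
  2≤2^ = *-monoʳ-≤ 2 (m^n>0 2 (suc m))
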